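{- Let $G$ be a profinite group, let $0\to A_0\xrightarrow{\alpha_0}A_1\xrightarrow{\alpha_1}A_2\xrightarrow{\alpha_2}A_3\to0$ be an exact sequence of discrete $G$-modules, and suppose it is the top row of a commutative $3\times4$ diagram of discrete $G$-modules with rows $A_\bullet$, $B_\bullet$ ($B_0\xrightarrow{\beta_0}B_1\xrightarrow{\beta_1}B_2\xrightarrow{\beta_2}B_3$), $C_\bullet$ ($C_0\xrightarrow{\gamma_0}C_1\xrightarrow{\gamma_1}C_2\xrightarrow{\gamma_2}C_3$), each exact with injective first and surjective last map, and with exact columns $0\to A_i\xrightarrow{\iota_i}B_i\xrightarrow{\pi_i}C_i\to0$ ($i=0,\dots,3$). Assume the connecting homomorphism $\partial_1\colon C_1^G\to H^1(G,A_1)$ is surjective. Then $\theta=-\theta'$ as maps $\ker[H^1(G,A_1)\xrightarrow{\alpha_1}H^1(G,A_2)]\to\mathrm{Coker}[A_2^G\xrightarrow{\alpha_2}A_3^G]$.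
   Context: $\theta$ is defined as follows: with $A:=\mathrm{Im}(\alpha_1)$ and short exact sequences $0\to A_0\to A_1\to A\to0$, $0\to A\to A_2\to A_3\to0$, $\theta$ is the composite of the map $\ker[H^1(G,A_1)\to H^1(G,A_2)]\to\ker[H^1(G,A)\to H^1(G,A_2)]$ induced by $A_1\to A$ with the inverse of the isomorphism $\mathrm{Coker}[A_2^G\to A_3^G]\xrightarrow{\sim}\ker[H^1(G,A)\to H^1(G,A_2)]$ induced by the connecting map $A_3^G\to H^1(G,A)$. $\theta'$ is defined as follows: for $z$ in the kernel, choose $c_1\in C_1^G$ with $\partial_1(c_1)=z$, choose $b_2\in B_2^G$ with $\pi_2(b_2)=\gamma_1(c_1)$, let $a_3\in A_3^G$ be the unique element with $\iota_3(a_3)=\beta_2(b_2)$, and set $\theta'(z):=a_3+\alpha_2(A_2^G)$ (this is a well-defined homomorphism). -}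

module Defs where

open import Data.Product using (Σ; Σ-syntax; _×_; _,_)
open import Data.Sum using (_⊎_)
open import Data.Unit using (⊤)
open import Data.Empty using (⊥)
open import Data.List using (List)
open import Data.List.Relation.Unary.Any using (Any)
open import Relation.Nullary using (¬_)
open import Relation.Binary.PropositionalEquality using (_≡_; _≢_)
open import Algebra.Structures using (IsGroup; IsAbelianGroup)

Subset : Set → Set₁
Subset X = X → Set

record Topology (X : Set) : Set₁ where
  field
    Open      : Subset X → Set
    -- openness does not depend on the chosen predicate representing a subset
    open-ext  : ∀ {U V : Subset X} → (∀ x → U x → V x) → (∀ x → V x → U x) → Open U → Open V
    open-univ : Open (λ _ → ⊤)
    open-∩    : ∀ {U V : Subset X} → Open U → Open V → Open (λ x → U x × V x)
    open-⋃    : ∀ {I : Set} (U : I → Subset X) → (∀ i → Open (U i)) → Open (λ x → Σ[ i ∈ I ] U i x)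

module _ {X : Set} (T : Topology X) where
  open Topology T

  Compact : Set₁
  Compact = ∀ {I : Set} (U : I → Subset X) → (∀ i → Open (U i)) → (∀ x → Σ[ i ∈ I ] U i x) →
            Σ[ is ∈ List I ] (∀ x → Any (λ i → U i x) is)

  Hausdorff : Set₁
  Hausdorff = ∀ x y → x ≢ y → Σ[ U ∈ Subset X ] Σ[ V ∈ Subset X ]
              (Open U × Open V × U x × V y × (∀ w → U w → V w → ⊥))

  Connected : Subset X → Set₁
  Connected S = ∀ (U V : Subset X) → Open U → Open V →
                (∀ x → S x → U x ⊎ V x) → (∀ x → S x → U x → V x → ⊥) →
                ¬ ((Σ[ x ∈ X ] (S x × U x)) × (Σ[ y ∈ X ] (S y × V y)))

  TotallyDisconnected : Set₁
  TotallyDisconnected = ∀ (S : Subset X) → Connected S → ∀ x y → S x → S y → x ≡ y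

record ProfiniteGroup : Set₁ where
  infixl 7 _·_
  field
    Carrier  : Set
    _·_      : Carrier → Carrier → Carrier
    e        : Carrier
    _⁻¹      : Carrier → Carrier
    isGroup  : IsGroup _≡_ _·_ e _⁻¹
    topology : Topology Carrier
  open Topology topology
  field
    ·-continuous : ∀ (W : Subset Carrier) → Open W → ∀ x y → W (x · y) →
                   Σ[ U ∈ Subset Carrier ] Σ[ V ∈ Subset Carrier ]
                   (Open U × Open V × U x × V y × (∀ u v → U u → V v → W (u · v)))
    ⁻¹-continuous : ∀ (W : Subset Carrier) → Open W → Open (λ x → W (x ⁻¹))
    compact       : Compact topology
    hausdorff     : Hausdorff topology
    totallyDisc   : TotallyDisconnected topology

record DiscreteModule (G : ProfiniteGroup) : Set₁ where
  open ProfiniteGroup G renaming (Carrier to |G|)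
  open Topology topology
  infixl 6 _+_ _-_
  infixr 7 _•_
  field
    Carrier        : Set
    _+_            : Carrier → Carrier → Carrier
    0#             : Carrier
    -_             : Carrier → Carrier
    isAbelianGroup : IsAbelianGroup _≡_ _+_ 0# -_
    _•_            : |G| → Carrier → Carrier
    •-identity     : ∀ m → e • m ≡ m
    •-assoc        : ∀ g h m → (g · h) • m ≡ g • (h • m)
    •-+            : ∀ g m n → g • (m + n) ≡ g • m + g • n
    discrete       : ∀ m → Open (λ g → g • m ≡ m)

  _-_ : Carrier → Carrier → Carrier
  m - n = m + (- n)

  Invariant : Carrier → Set
  Invariant m = ∀ g → g • m ≡ m

  Cochain : Set
  Cochain = |G| → Carrier

  -- continuity into the discrete space M: preimage of every subset is open
  IsContinuous : Cochain → Set₁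
  IsContinuous z = ∀ (S : Subset Carrier) → Open (λ g → S (z g))

  IsCocycle : Cochain → Set
  IsCocycle z = ∀ g h → z (g · h) ≡ z g + g • z h

  -- equality of classes in H¹(G,M): differ by the coboundary g ↦ g•m - m
  Cohomologous : Cochain → Cochain → Set
  Cohomologous z z' = Σ[ m ∈ Carrier ] (∀ g → z g ≡ z' g + (g • m - m))

  -- class zero in H¹(G,M)
  IsCoboundary : Cochain → Set
  IsCoboundary z = Σ[ m ∈ Carrier ] (∀ g → z g ≡ g • m - m)

open DiscreteModule using (Carrier; 0#)

record Hom {G : ProfiniteGroup} (M N : DiscreteModule G) : Set where
  private
    module M = DiscreteModule M
    module N = DiscreteModule N
  field
    fun         : M.Carrier → N.Carrier
    additive    : ∀ x y → fun (x M.+ y) ≡ fun x N.+ fun y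
    equivariant : ∀ g x → fun (g M.• x) ≡ g N.• fun x

open Hom public using (fun)

module _ {G : ProfiniteGroup} where

  Injective : {M N : DiscreteModule G} → Hom M N → Set
  Injective f = ∀ x y → fun f x ≡ fun f y → x ≡ y

  Surjective : {M N : DiscreteModule G} → Hom M N → Set
  Surjective {N = N} f = ∀ y → Σ[ x ∈ _ ] fun f x ≡ y

  Exact : {M N P : DiscreteModule G} → Hom M N → Hom N P → Set
  Exact {M} {N} {P} f g =
    (∀ x → fun g (fun f x) ≡ 0# P) × (∀ y → fun g y ≡ 0# P → Σ[ x ∈ Carrier M ] fun f x ≡ y)

  Commutes : {M N P Q : DiscreteModule G} → Hom M N → Hom N Q → Hom M P → Hom P Q → Set
  Commutes {M} f g h k = ∀ x → fun g (fun f x) ≡ fun k (fun h x)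

-- The 3×4 diagram
--     A₀ → A₁ → A₂ → A₃      (α)
--     ↓ι   ↓ι   ↓ι   ↓ι
--     B₀ → B₁ → B₂ → B₃      (β)
--     ↓π   ↓π   ↓π   ↓π
--     C₀ → C₁ → C₂ → C₃      (γ)

record Diagram (G : ProfiniteGroup) : Set₁ where
  field
    A₀ A₁ A₂ A₃ B₀ B₁ B₂ B₃ C₀ C₁ C₂ C₃ : DiscreteModule G
    α₀ : Hom A₀ A₁
    α₁ : Hom A₁ A₂
    α₂ : Hom A₂ A₃
    β₀ : Hom B₀ B₁
    β₁ : Hom B₁ B₂
    β₂ : Hom B₂ B₃
    γ₀ : Hom C₀ C₁
    γ₁ : Hom C₁ C₂
    γ₂ : Hom C₂ C₃
    ι₀ : Hom A₀ B₀
    ι₁ : Hom A₁ B₁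
    ι₂ : Hom A₂ B₂
    ι₃ : Hom A₃ B₃
    π₀ : Hom B₀ C₀
    π₁ : Hom B₁ C₁
    π₂ : Hom B₂ C₂
    π₃ : Hom B₃ C₃
    α₀-inj : Injective α₀
    α-exact₁ : Exact α₀ α₁
    α-exact₂ : Exact α₁ α₂
    α₂-surj : Surjective α₂
    β₀-inj : Injective β₀
    β-exact₁ : Exact β₀ β₁
    β-exact₂ : Exact β₁ β₂
    β₂-surj : Surjective β₂
    γ₀-inj : Injective γ₀
    γ-exact₁ : Exact γ₀ γ₁
    γ-exact₂ : Exact γ₁ γ₂
    γ₂-surj : Surjective γ₂
    ι₀-inj : Injective ι₀
    ι₁-inj : Injective ι₁
    ι₂-inj : Injective ι₂
    ι₃-inj : Injective ι₃
    col-exact₀ : Exact ι₀ π₀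
    col-exact₁ : Exact ι₁ π₁
    col-exact₂ : Exact ι₂ π₂
    col-exact₃ : Exact ι₃ π₃
    π₀-surj : Surjective π₀
    π₁-surj : Surjective π₁
    π₂-surj : Surjective π₂
    π₃-surj : Surjective π₃
    sq-AB₀ : Commutes α₀ ι₁ ι₀ β₀
    sq-AB₁ : Commutes α₁ ι₂ ι₁ β₁
    sq-AB₂ : Commutes α₂ ι₃ ι₂ β₂
    sq-BC₀ : Commutes β₀ π₁ π₀ γ₀
    sq-BC₁ : Commutes β₁ π₂ π₁ γ₁
    sq-BC₂ : Commutes β₂ π₃ π₂ γ₂

module Maps {G : ProfiniteGroup} (D : Diagram G) where
  open ProfiniteGroup G using () renaming (Carrier to |G|)
  open Diagram D
  private
    module A₁ = DiscreteModule A₁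
    module A₂ = DiscreteModule A₂
    module A₃ = DiscreteModule A₃
    module B₁ = DiscreteModule B₁
    module B₂ = DiscreteModule B₂
    module C₁ = DiscreteModule C₁

  -- ∂₁ : C₁^G → H¹(G,A₁) sends c to the class of z' where ι₁(z' g) = g•b - b, π₁ b = c.
  -- "∂₁ c = [z]":
  ∂₁-Hits : C₁.Carrier → A₁.Cochain → Set
  ∂₁-Hits c z = Σ[ b ∈ B₁.Carrier ] (fun π₁ b ≡ c ×
                Σ[ z' ∈ A₁.Cochain ] ((∀ g → g B₁.• b B₁.- b ≡ fun ι₁ (z' g)) × A₁.Cohomologous z' z))

  ∂₁-Surjective : Set₁
  ∂₁-Surjective = ∀ (z : A₁.Cochain) → A₁.IsContinuous z → A₁.IsCocycle z →
                  Σ[ c ∈ C₁.Carrier ] (C₁.Invariant c × ∂₁-Hits c z)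

  InKernel : A₁.Cochain → Set
  InKernel z = A₂.IsCoboundary (λ g → fun α₁ (z g))

  -- θ([z]) = class of a₃: a₃ ∈ A₃^G, and the image of [z] in H¹(G,A), A = Im α₁ ⊆ A₂,
  -- equals δ(a₃) = [g ↦ g•a₂ - a₂] for a lift a₂ of a₃ (equality in H¹(G,A),
  -- i.e. up to the coboundary of an element α₁ a₁ of A).
  θ-Rel : A₁.Cochain → A₃.Carrier → Set
  θ-Rel z a₃ = A₃.Invariant a₃ × Σ[ a₂ ∈ A₂.Carrier ] Σ[ a₁ ∈ A₁.Carrier ]
               (fun α₂ a₂ ≡ a₃ ×
                (∀ g → fun α₁ (z g) ≡ (g A₂.• a₂ A₂.- a₂) A₂.+ (g A₂.• fun α₁ a₁ A₂.- fun α₁ a₁)))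

  θ'-Rel : A₁.Cochain → A₃.Carrier → Set
  θ'-Rel z a₃ = Σ[ c₁ ∈ C₁.Carrier ] (C₁.Invariant c₁ × ∂₁-Hits c₁ z ×
                Σ[ b₂ ∈ B₂.Carrier ] (B₂.Invariant b₂ × fun π₂ b₂ ≡ fun γ₁ c₁ ×
                  fun ι₃ a₃ ≡ fun β₂ b₂))

  -- equality of classes in Coker[A₂^G → A₃^G]: x - y ∈ α₂(A₂^G)
  CokerEq : A₃.Carrier → A₃.Carrier → Set
  CokerEq x y = Σ[ a₂ ∈ A₂.Carrier ] (A₂.Invariant a₂ × fun α₂ a₂ ≡ x A₃.- y)

{-# OPTIONS --safe #-}
module Submission where

-- Choose y ∈ A₂ with ι₂ y = b₂ − β₁ b, where b ∈ B₁ is the lift of c₁ and b₂ ∈ B₂^G the lift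
-- of γ₁ c₁ used to compute θ'. Then α₂ y = a₃' and the coboundary of y is −α₁ z', while the data
-- defining θ give u ∈ A₂ with α₂ u = a₃ and coboundary α₁ z'. Hence y + u is G-invariant and
-- α₂ (y + u) = a₃ + a₃', i.e. a₃ ≡ −a₃' in Coker[A₂^G → A₃^G].

open import Defs
open import Algebra.Bundles using (Group; AbelianGroup)
open import Algebra.Core using (Op₁; Op₂)
open import Algebra.Structures using (IsGroup)
import Algebra.Properties.AbelianGroup as AbelianGroupProperties
import Algebra.Properties.CommutativeSemigroup as CommutativeSemigroupProperties
import Algebra.Properties.Group as GroupProperties
open import Data.Product using (Σ-syntax; _×_; _,_; proj₁; proj₂)
open import Level using (0ℓ)
open import Relation.Binary.PropositionalEquality
  using (_≡_; sym; trans; cong; cong₂; module ≡-Reasoning)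

module GroupHomomorphism
  {A B : Set} {_∙₁_ : Op₂ A} {ε₁ : A} {_⁻¹₁ : Op₁ A} {_∙₂_ : Op₂ B} {ε₂ : B} {_⁻¹₂ : Op₁ B}
  (A-isGroup : IsGroup _≡_ _∙₁_ ε₁ _⁻¹₁) (B-isGroup : IsGroup _≡_ _∙₂_ ε₂ _⁻¹₂)
  (f : A → B) (∙-homo : ∀ x y → f (x ∙₁ y) ≡ f x ∙₂ f y) where

  private
    module A = IsGroup A-isGroup
    B-group : Group 0ℓ 0ℓ
    B-group = record { isGroup = B-isGroup }
    open GroupProperties B-group using (identityʳ-unique; inverseʳ-unique)

  ε-homo : f ε₁ ≡ ε₂
  ε-homo = identityʳ-unique (f ε₁) (f ε₁) (trans (sym (∙-homo ε₁ ε₁)) (cong f (A.identityˡ ε₁)))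

  ⁻¹-homo : ∀ x → f (x ⁻¹₁) ≡ f x ⁻¹₂
  ⁻¹-homo x = inverseʳ-unique (f x) (f (x ⁻¹₁))
    (trans (sym (∙-homo x (x ⁻¹₁))) (trans (cong f (A.inverseʳ x)) ε-homo))

module ModuleProperties {G : ProfiniteGroup} (M : DiscreteModule G) where
  open DiscreteModule M public
  open ≡-Reasoning

  abelianGroup : AbelianGroup 0ℓ 0ℓ
  abelianGroup = record { isAbelianGroup = isAbelianGroup }

  open AbelianGroup abelianGroup public
    using (isGroup; assoc; comm; identityˡ; identityʳ; inverseˡ; inverseʳ)
  open AbelianGroupProperties abelianGroup public using (⁻¹-involutive; ⁻¹-∙-comm)
  open CommutativeSemigroupProperties (AbelianGroup.commutativeSemigroup abelianGroup)
    public using (interchange)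

  •-⁻¹ : ∀ g m → g • (- m) ≡ - (g • m)
  •-⁻¹ g = GroupHomomorphism.⁻¹-homo isGroup isGroup (g •_) (•-+ g)

  coboundary : Carrier → Cochain
  coboundary m g = g • m - m

  coboundary-+ : ∀ m n g → coboundary (m + n) g ≡ coboundary m g + coboundary n g
  coboundary-+ m n g = begin
    g • (m + n) + - (m + n)         ≡⟨ cong₂ _+_ (•-+ g m n) (sym (⁻¹-∙-comm m n)) ⟩
    (g • m + g • n) + (- m + - n)   ≡⟨ interchange (g • m) (g • n) (- m) (- n) ⟩
    coboundary m g + coboundary n g ∎

  coboundary-⁻¹ : ∀ m g → coboundary (- m) g ≡ - coboundary m g
  coboundary-⁻¹ m g = begin
    g • (- m) + - (- m)      ≡⟨ cong (_+ - (- m)) (•-⁻¹ g m) ⟩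
    - (g • m) + - (- m)      ≡⟨ ⁻¹-∙-comm (g • m) (- m) ⟩
    - coboundary m g         ∎

  coboundary-invariant : ∀ {m} → Invariant m → ∀ g → coboundary m g ≡ 0#
  coboundary-invariant {m} m-inv g = trans (cong (_- m) (m-inv g)) (inverseʳ m)

  coboundary≡0⇒invariant : ∀ m → (∀ g → coboundary m g ≡ 0#) → Invariant m
  coboundary≡0⇒invariant m ∂m≡0 g = begin
    g • m                   ≡⟨ sym (identityʳ (g • m)) ⟩
    g • m + 0#              ≡⟨ cong (g • m +_) (sym (inverseˡ m)) ⟩
    g • m + (- m + m)       ≡⟨ sym (assoc (g • m) (- m) m) ⟩
    coboundary m g + m      ≡⟨ cong (_+ m) (∂m≡0 g) ⟩
    0# + m                  ≡⟨ identityˡ m ⟩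
    m                       ∎

  invariant-of-opposite-coboundaries : ∀ m n → (∀ g → coboundary m g ≡ - coboundary n g) →
                                       Invariant (m + n)
  invariant-of-opposite-coboundaries m n ∂m≡-∂n = coboundary≡0⇒invariant (m + n) λ g → begin
    coboundary (m + n) g                ≡⟨ coboundary-+ m n g ⟩
    coboundary m g + coboundary n g     ≡⟨ cong (_+ coboundary n g) (∂m≡-∂n g) ⟩
    - coboundary n g + coboundary n g   ≡⟨ inverseˡ (coboundary n g) ⟩
    0#                                  ∎

module HomProperties {G : ProfiniteGroup} {M N : DiscreteModule G} (f : Hom M N) where
  private
    module M = ModuleProperties M
    module N = ModuleProperties N
  open Hom f public using (additive; equivariant)
  open ≡-Reasoning

  open GroupHomomorphism M.isGroup N.isGroup (fun f) additive public

  coboundary-homo : ∀ m g → fun f (M.coboundary m g) ≡ N.coboundary (fun f m) g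
  coboundary-homo m g = begin
    fun f (g M.• m M.+ M.- m)             ≡⟨ additive (g M.• m) (M.- m) ⟩
    fun f (g M.• m) N.+ fun f (M.- m)     ≡⟨ cong₂ N._+_ (equivariant g m) (⁻¹-homo m) ⟩
    N.coboundary (fun f m) g              ∎

module DiagramChase {G : ProfiniteGroup} (D : Diagram G) where
  open Diagram D
  open Maps D
  module A₁ = ModuleProperties A₁
  module A₂ = ModuleProperties A₂
  module A₃ = ModuleProperties A₃
  module B₁ = ModuleProperties B₁
  module B₂ = ModuleProperties B₂
  module B₃ = ModuleProperties B₃
  module C₂ = ModuleProperties C₂
  open ≡-Reasoning

  α₂∘α₁≡0 : ∀ a → fun α₂ (fun α₁ a) ≡ A₃.0#
  α₂∘α₁≡0 = proj₁ α-exact₂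

  difference-lifts-to-A₂ : ∀ b b₂ → fun π₂ b₂ ≡ fun γ₁ (fun π₁ b) →
                          Σ[ y ∈ A₂.Carrier ] fun ι₂ y ≡ b₂ B₂.- fun β₁ b
  difference-lifts-to-A₂ b b₂ π₂b₂≡γ₁π₁b = proj₂ col-exact₂ (b₂ B₂.- fun β₁ b) (begin
    fun π₂ (b₂ B₂.- fun β₁ b)                 ≡⟨ HomProperties.additive π₂ b₂ (B₂.- fun β₁ b) ⟩
    fun π₂ b₂ C₂.+ fun π₂ (B₂.- fun β₁ b)     ≡⟨ cong (fun π₂ b₂ C₂.+_) (HomProperties.⁻¹-homo π₂ (fun β₁ b)) ⟩
    fun π₂ b₂ C₂.- fun π₂ (fun β₁ b)          ≡⟨ cong (λ t → fun π₂ b₂ C₂.- t) (trans (sq-BC₁ b) (sym π₂b₂≡γ₁π₁b)) ⟩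
    fun π₂ b₂ C₂.- fun π₂ b₂                  ≡⟨ C₂.inverseʳ (fun π₂ b₂) ⟩
    C₂.0#                                     ∎)

  α₂-of-lift : ∀ {y b b₂} → fun ι₂ y ≡ b₂ B₂.- fun β₁ b → fun ι₃ (fun α₂ y) ≡ fun β₂ b₂
  α₂-of-lift {y} {b} {b₂} ι₂y≡b₂-β₁b = begin
    fun ι₃ (fun α₂ y)                         ≡⟨ sq-AB₂ y ⟩
    fun β₂ (fun ι₂ y)                         ≡⟨ cong (fun β₂) ι₂y≡b₂-β₁b ⟩
    fun β₂ (b₂ B₂.- fun β₁ b)                 ≡⟨ HomProperties.additive β₂ b₂ (B₂.- fun β₁ b) ⟩
    fun β₂ b₂ B₃.+ fun β₂ (B₂.- fun β₁ b)     ≡⟨ cong (fun β₂ b₂ B₃.+_) β₂-kills-β₁ ⟩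
    fun β₂ b₂ B₃.+ B₃.0#                      ≡⟨ B₃.identityʳ (fun β₂ b₂) ⟩
    fun β₂ b₂                                 ∎
    where
    β₂-kills-β₁ : fun β₂ (B₂.- fun β₁ b) ≡ B₃.0#
    β₂-kills-β₁ = trans (cong (fun β₂) (sym (HomProperties.⁻¹-homo β₁ b))) (proj₁ β-exact₂ (B₁.- b))

  coboundary-of-lift : ∀ {y b b₂} {w : A₁.Cochain} → B₂.Invariant b₂ →
                       fun ι₂ y ≡ b₂ B₂.- fun β₁ b → (∀ g → B₁.coboundary b g ≡ fun ι₁ (w g)) →
                       ∀ g → A₂.coboundary y g ≡ A₂.- fun α₁ (w g)
  coboundary-of-lift {y} {b} {b₂} {w} b₂-inv ι₂y≡b₂-β₁b ∂b≡ι₁w g = ι₂-inj _ _ (begin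
    fun ι₂ (A₂.coboundary y g)                      ≡⟨ HomProperties.coboundary-homo ι₂ y g ⟩
    B₂.coboundary (fun ι₂ y) g                      ≡⟨ cong (λ t → B₂.coboundary t g) ι₂y≡b₂-β₁b ⟩
    B₂.coboundary (b₂ B₂.- fun β₁ b) g              ≡⟨ B₂.coboundary-+ b₂ (B₂.- fun β₁ b) g ⟩
    B₂.coboundary b₂ g B₂.+ B₂.coboundary (B₂.- fun β₁ b) g
      ≡⟨ cong₂ B₂._+_ (B₂.coboundary-invariant b₂-inv g) (B₂.coboundary-⁻¹ (fun β₁ b) g) ⟩
    B₂.0# B₂.+ B₂.- B₂.coboundary (fun β₁ b) g     ≡⟨ B₂.identityˡ _ ⟩
    B₂.- B₂.coboundary (fun β₁ b) g                 ≡⟨ cong B₂.-_ (sym (HomProperties.coboundary-homo β₁ b g)) ⟩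
    B₂.- fun β₁ (B₁.coboundary b g)                 ≡⟨ cong (λ t → B₂.- fun β₁ t) (∂b≡ι₁w g) ⟩
    B₂.- fun β₁ (fun ι₁ (w g))                      ≡⟨ cong B₂.-_ (sym (sq-AB₁ (w g))) ⟩
    B₂.- fun ι₂ (fun α₁ (w g))                      ≡⟨ sym (HomProperties.⁻¹-homo ι₂ (fun α₁ (w g))) ⟩
    fun ι₂ (A₂.- fun α₁ (w g))                      ∎)

  θ'-lift : ∀ {z a₃'} → θ'-Rel z a₃' →
            Σ[ z' ∈ A₁.Cochain ] A₁.Cohomologous z' z ×
            Σ[ y ∈ A₂.Carrier ] (fun α₂ y ≡ a₃' × ∀ g → A₂.coboundary y g ≡ A₂.- fun α₁ (z' g))
  θ'-lift {a₃' = a₃'} (c₁ , _ , (b , π₁b≡c₁ , z' , ∂b≡ι₁z' , z'~z) , b₂ , b₂-inv , π₂b₂≡γ₁c₁ , ι₃a₃'≡β₂b₂)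
    with difference-lifts-to-A₂ b b₂ (trans π₂b₂≡γ₁c₁ (cong (fun γ₁) (sym π₁b≡c₁)))
  ... | y , ι₂y≡b₂-β₁b =
    z' , z'~z , y , ι₃-inj _ _ (trans (α₂-of-lift ι₂y≡b₂-β₁b) (sym ι₃a₃'≡β₂b₂)) ,
    coboundary-of-lift b₂-inv ι₂y≡b₂-β₁b ∂b≡ι₁z'

  θ-lift : ∀ {z z' a₃} → θ-Rel z a₃ → A₁.Cohomologous z' z →
           Σ[ u ∈ A₂.Carrier ] (fun α₂ u ≡ a₃ × ∀ g → fun α₁ (z' g) ≡ A₂.coboundary u g)
  θ-lift {z} {z'} {a₃} (_ , a₂ , a₁ , α₂a₂≡a₃ , α₁z≡∂) (m , z'≡z+∂m) =
    u , α₂u≡a₃ , α₁z'≡∂u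
    where
    u : A₂.Carrier
    u = (a₂ A₂.+ fun α₁ a₁) A₂.+ fun α₁ m

    α₂u≡a₃ : fun α₂ u ≡ a₃
    α₂u≡a₃ = begin
      fun α₂ u
        ≡⟨ HomProperties.additive α₂ (a₂ A₂.+ fun α₁ a₁) (fun α₁ m) ⟩
      fun α₂ (a₂ A₂.+ fun α₁ a₁) A₃.+ fun α₂ (fun α₁ m)
        ≡⟨ cong₂ A₃._+_ (HomProperties.additive α₂ a₂ (fun α₁ a₁)) (α₂∘α₁≡0 m) ⟩
      (fun α₂ a₂ A₃.+ fun α₂ (fun α₁ a₁)) A₃.+ A₃.0#
        ≡⟨ A₃.identityʳ _ ⟩
      fun α₂ a₂ A₃.+ fun α₂ (fun α₁ a₁)
        ≡⟨ cong₂ A₃._+_ α₂a₂≡a₃ (α₂∘α₁≡0 a₁) ⟩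
      a₃ A₃.+ A₃.0#
        ≡⟨ A₃.identityʳ a₃ ⟩
      a₃ ∎

    α₁z'≡∂u : ∀ g → fun α₁ (z' g) ≡ A₂.coboundary u g
    α₁z'≡∂u g = begin
      fun α₁ (z' g)
        ≡⟨ cong (fun α₁) (z'≡z+∂m g) ⟩
      fun α₁ (z g A₁.+ A₁.coboundary m g)
        ≡⟨ HomProperties.additive α₁ (z g) (A₁.coboundary m g) ⟩
      fun α₁ (z g) A₂.+ fun α₁ (A₁.coboundary m g)
        ≡⟨ cong₂ A₂._+_ (α₁z≡∂ g) (HomProperties.coboundary-homo α₁ m g) ⟩
      (A₂.coboundary a₂ g A₂.+ A₂.coboundary (fun α₁ a₁) g) A₂.+ A₂.coboundary (fun α₁ m) g
        ≡⟨ cong (A₂._+ A₂.coboundary (fun α₁ m) g) (sym (A₂.coboundary-+ a₂ (fun α₁ a₁) g)) ⟩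
      A₂.coboundary (a₂ A₂.+ fun α₁ a₁) g A₂.+ A₂.coboundary (fun α₁ m) g
        ≡⟨ sym (A₂.coboundary-+ (a₂ A₂.+ fun α₁ a₁) (fun α₁ m) g) ⟩
      A₂.coboundary u g ∎

-- Surjectivity of ∂₁ (like continuity, the cocycle condition and InKernel) only guarantees that
-- θ' is defined on the whole kernel; the identity itself needs just the data in θ-Rel and θ'-Rel.
lemmaA2 : (G : ProfiniteGroup) (D : Diagram G) → Maps.∂₁-Surjective D →
    (z : DiscreteModule.Cochain (Diagram.A₁ D)) →
    DiscreteModule.IsContinuous (Diagram.A₁ D) z →
    DiscreteModule.IsCocycle (Diagram.A₁ D) z →
    Maps.InKernel D z →
    (a₃ a₃' : DiscreteModule.Carrier (Diagram.A₃ D)) →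
    Maps.θ-Rel D z a₃ → Maps.θ'-Rel D z a₃' →
    Maps.CokerEq D a₃ (DiscreteModule.-_ (Diagram.A₃ D) a₃')
lemmaA2 G D _ z _ _ _ a₃ a₃' θ-data θ'-data with DiagramChase.θ'-lift D θ'-data
... | z' , z'~z , y , α₂y≡a₃' , ∂y≡-α₁z' with DiagramChase.θ-lift D θ-data z'~z
... | u , α₂u≡a₃ , α₁z'≡∂u =
  y A₂.+ u ,
  A₂.invariant-of-opposite-coboundaries y u (λ g → trans (∂y≡-α₁z' g) (cong A₂.-_ (α₁z'≡∂u g))) ,
  (begin
    fun α₂ (y A₂.+ u)      ≡⟨ HomProperties.additive α₂ y u ⟩
    fun α₂ y A₃.+ fun α₂ u ≡⟨ cong₂ A₃._+_ α₂y≡a₃' α₂u≡a₃ ⟩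
    a₃' A₃.+ a₃            ≡⟨ A₃.comm a₃' a₃ ⟩
    a₃ A₃.+ a₃'            ≡⟨ cong (a₃ A₃.+_) (sym (A₃.⁻¹-involutive a₃')) ⟩
    a₃ A₃.- (A₃.- a₃')     ∎)
  where
  open Diagram D using (α₂)
  open DiagramChase D using (module A₂; module A₃)
  open ≡-Reasoning
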